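{- Let $k\ge 1$ and $d\ge 1$ be integers. On every $(k,d)$-bounded instance of online ad allocation whose maximum bid-to-budget ratio $R_{\max}=\max_{(i,j)\in E} b_{ij}/B_i$ satisfies $R_{\max}<1$, algorithm GREEDY (with any tie-breaking) obtains value at least $\frac{(1-R_{\max})\cdot k}{k+(d-1)\cdot(1-R_{\max})}$ times the optimum offline value; note $\frac{(1-R_{\max})\cdot k}{k+(d-1)(1-R_{\max})}>(1-R_{\max})\cdot\frac{k}{k+d-1}$.
   Context: Online ad allocation: a bipartite graph $G=(L,R,E)$; each advertiser $i\in L$ has a budget $B_i>0$ and a bid $0<b_{ij}\le B_i$ for each neighbor $j\in N(i)$. Advertisers and budgets are known in advance; ad slots $j\in R$ arrive one at a time with their incident edges and bids, and on arrival must be irrevocably allocated to at most one feasible advertiser $i$ (residual budget at least $b_{ij}$), yielding profit $b_{ij}$; the goal is to maximize total profit. GREEDY allocates each arriving ad slot $j$ (if it has a feasible neighbor) to a feasible neighbor $i$ maximizing $b_{ij}$, ties broken arbitrarily. An instance is $(k,d)$-bounded if every ad slot has degree at most $d$ and every advertiser $i$ satisfies $\sum_{j\in N(i)} b_{ij}\ge k\cdot B_i$.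
   Formalization: The budgets $B_i$ and bids $b_{ij}$ take values in the rationals, so the ratio $R_{\max}$ is rational as well. -}

module Defs where

open import Data.Nat using (ℕ; zero; suc; _≤_)
open import Data.Fin using (Fin; zero; suc; toℕ)
open import Data.Bool using (Bool; true; false; if_then_else_)
open import Data.Maybe using (Maybe; just; nothing)
open import Data.Product using (_×_; Σ; ∃; ∃-syntax; _,_)
open import Data.Empty using (⊥)
open import Relation.Binary.PropositionalEquality using (_≡_)
open import Relation.Nullary using (¬_; Dec; yes; no)
open import Data.Integer using (+_)
open import Data.Rational using (ℚ; 0ℚ; 1ℚ; _+_; _*_; _-_) renaming (_≤_ to _≤ℚ_; _<_ to _<ℚ_)
import Data.Rational as Q
import Data.Nat as N
import Data.Fin as F

ℕ→ℚ : ℕ → ℚ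
ℕ→ℚ n = (+ n) Q./ 1

sumℚ : (n : ℕ) → (Fin n → ℚ) → ℚ
sumℚ zero    f = 0ℚ
sumℚ (suc n) f = f zero + sumℚ n (λ j → f (suc j))

count : (n : ℕ) → (Fin n → Bool) → ℕ
count zero    p = 0
count (suc n) p = (if p zero then 1 else 0) N.+ count n (λ j → p (suc j))

-- An instance with advertisers L = Fin nL and ad slots R = Fin nR.
-- Ad slots arrive in the order 0, 1, ..., nR - 1.
-- adj i j ≡ true  iff  (i , j) ∈ E ; bids are only meaningful on edges.
record Instance (nL nR : ℕ) : Set where
  field
    B     : Fin nL → ℚ
    adj   : Fin nL → Fin nR → Bool
    b     : Fin nL → Fin nR → ℚ
    B-pos : ∀ i → 0ℚ <ℚ B i
    b-pos : ∀ i j → adj i j ≡ true → 0ℚ <ℚ b i j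
    b-≤B  : ∀ i j → adj i j ≡ true → b i j ≤ℚ B i

open Instance public

Allocation : ℕ → ℕ → Set
Allocation nL nR = Fin nR → Maybe (Fin nL)

_≟F_ : ∀ {n} → (x y : Fin n) → Bool
x ≟F y with x F.≟ y
... | yes _ = true
... | no  _ = false

gain : ∀ {nL nR} → Instance nL nR → Allocation nL nR → Fin nR → ℚ
gain I σ j with σ j
... | just i  = b I i j
... | nothing = 0ℚ

value : ∀ {nL nR} → Instance nL nR → Allocation nL nR → ℚ
value {nR = nR} I σ = sumℚ nR (gain I σ)

assignedTo : ∀ {nL nR} → Allocation nL nR → Fin nL → Fin nR → Bool
assignedTo σ i j with σ j
... | just i' = i' ≟F i
... | nothing = false

spentOn : ∀ {nL nR} → Instance nL nR → Allocation nL nR → Fin nL →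
          (Fin nR → Bool) → ℚ
spentOn {nR = nR} I σ i inc =
  sumℚ nR (λ j → if inc j then (if assignedTo σ i j then b I i j else 0ℚ) else 0ℚ)

spent : ∀ {nL nR} → Instance nL nR → Allocation nL nR → Fin nL → ℚ
spent I σ i = spentOn I σ i (λ _ → true)

-- j' arrives strictly before j
before : ∀ {nR} → Fin nR → Fin nR → Bool
before j j' with toℕ j' N.<? toℕ j
... | yes _ = true
... | no  _ = false

residual : ∀ {nL nR} → Instance nL nR → Allocation nL nR → Fin nL → Fin nR → ℚ
residual I σ i j = B I i - spentOn I σ i (before j)

Feasible : ∀ {nL nR} → Instance nL nR → Allocation nL nR → Set
Feasible I σ =
  (∀ i j → σ j ≡ just i → adj I i j ≡ true) ×
  (∀ i → spent I σ i ≤ℚ B I i)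

FeasibleChoice : ∀ {nL nR} → Instance nL nR → Allocation nL nR → Fin nL → Fin nR → Set
FeasibleChoice I σ i j = (adj I i j ≡ true) × (b I i j ≤ℚ residual I σ i j)

-- σ is a possible run of GREEDY (for some tie-breaking rule): each arriving
-- ad slot j is allocated to a feasible neighbour of maximum bid if one
-- exists, and is left unallocated otherwise.
GreedyRun : ∀ {nL nR} → Instance nL nR → Allocation nL nR → Set
GreedyRun I σ = ∀ j →
  (∀ i → σ j ≡ just i →
     FeasibleChoice I σ i j × (∀ i' → FeasibleChoice I σ i' j → b I i' j ≤ℚ b I i j)) ×
  (σ j ≡ nothing → ∀ i → ¬ FeasibleChoice I σ i j)

Bounded : ∀ {nL nR} → ℕ → ℕ → Instance nL nR → Set
Bounded {nL} {nR} k d I =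
  (∀ j → count nL (λ i → adj I i j) ≤ d) ×
  (∀ i → ℕ→ℚ k * B I i ≤ℚ
           sumℚ nR (λ j → if adj I i j then b I i j else 0ℚ))

-- R is the maximum bid-to-budget ratio  max_{(i,j) ∈ E} b_ij / B_i
-- (b_ij / B_i ≤ R written as b_ij ≤ R * B_i, valid as B_i > 0).
IsRmax : ∀ {nL nR} → Instance nL nR → ℚ → Set
IsRmax I R =
  (∀ i j → adj I i j ≡ true → b I i j ≤ℚ R * B I i) ×
  (∃[ i ] ∃[ j ] (adj I i j ≡ true × b I i j ≡ R * B I i))

module Submission where

-- Write c = 1 − R and call advertiser i saturated when GREEDY spends X_i ≥ c·B_i on it.
-- A saturated advertiser gives c·k·B_i ≤ k·X_i.  An unsaturated one kept a residual
-- budget ≥ R·B_i ≥ b_ij at every arrival, so each neighbour j had i as a feasible choice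
-- and GREEDY earned at least b_ij on j; by (k,d)-boundedness k·B_i ≤ W_i, the greedy
-- gain on the neighbours of i.  Either way c·k·B_i + c·X_i ≤ k·X_i + c·W_i.  Summing over
-- i, ΣX_i is the greedy value A, ΣW_i ≤ d·A because every slot has at most d neighbours,
-- and OPT ≤ ΣB_i; rearranging gives c·k·OPT ≤ (k + (d − 1)·c)·A.

open import Defs
open import Algebra.Bundles using (CommutativeRing)
open import Data.Bool using (Bool; true; false; if_then_else_)
open import Data.Fin using (Fin; zero; suc; punchIn)
import Data.Fin as F
open import Data.Fin.Properties using (punchInᵢ≢i)
import Data.Integer as ℤ
import Data.Integer.Properties as ℤ
open import Data.Maybe using (just; nothing)
open import Data.Nat using (ℕ; zero; suc; _≤_; _∸_; z≤n; s≤s)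
import Data.Nat.Coprimality as Coprimality
open import Data.Product using (_×_; _,_; proj₁; proj₂)
open import Data.Rational using (ℚ; mkℚ; 0ℚ; 1ℚ; _+_; _*_; _-_; -_; *≤*; nonNegative)
  renaming (_≤_ to _≤ℚ_; _<_ to _<ℚ_)
open import Data.Rational.Properties
open import Data.Rational.Solver using (module +-*-Solver)
open import Data.Sum using (inj₁; inj₂)
open import Function using (_∘_)
open import Relation.Binary.PropositionalEquality
open import Relation.Nullary using (yes; no; contradiction)

open +-*-Solver using (solve; _:+_; _:*_; _:-_; _:=_; con)
open import Algebra.Properties.Semiring.Sum (CommutativeRing.semiring +-*-commutativeRing)
  using (sum; sum-cong-≗; sum-remove; sum-replicate-zero; ∑-distrib-+; ∑-comm; *-distribˡ-sum)

ℕ→ℚ≡mkℚ : ∀ m → ℕ→ℚ m ≡ mkℚ (ℤ.+ m) 0 (Coprimality.sym (Coprimality.1-coprimeTo m))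
ℕ→ℚ≡mkℚ m = normalize-coprime (Coprimality.sym (Coprimality.1-coprimeTo m))

ℕ→ℚ-suc : ∀ m → ℕ→ℚ (suc m) ≡ 1ℚ + ℕ→ℚ m
ℕ→ℚ-suc m rewrite ℕ→ℚ≡mkℚ m | ℤ.*-identityʳ (ℤ.+ m) = refl

ℕ→ℚ-mono-≤ : ∀ {m n} → m ≤ n → ℕ→ℚ m ≤ℚ ℕ→ℚ n
ℕ→ℚ-mono-≤ {m} {n} m≤n rewrite ℕ→ℚ≡mkℚ m | ℕ→ℚ≡mkℚ n =
  *≤* (ℤ.*-monoʳ-≤-nonNeg (ℤ.+ 1) (ℤ.+≤+ m≤n))

ℕ→ℚ-nonNeg : ∀ m → 0ℚ ≤ℚ ℕ→ℚ m
ℕ→ℚ-nonNeg m = ℕ→ℚ-mono-≤ {0} {m} z≤n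

sumℚ≡sum : ∀ n (f : Fin n → ℚ) → sumℚ n f ≡ sum f
sumℚ≡sum zero    f = refl
sumℚ≡sum (suc n) f = cong (f zero +_) (sumℚ≡sum n (f ∘ suc))

sumℚ-cong : ∀ n {f g : Fin n → ℚ} → (∀ j → f j ≡ g j) → sumℚ n f ≡ sumℚ n g
sumℚ-cong zero    f≗g = refl
sumℚ-cong (suc n) f≗g = cong₂ _+_ (f≗g zero) (sumℚ-cong n (f≗g ∘ suc))

sumℚ-mono-≤ : ∀ n {f g : Fin n → ℚ} → (∀ j → f j ≤ℚ g j) → sumℚ n f ≤ℚ sumℚ n g
sumℚ-mono-≤ zero    f≤g = ≤-refl
sumℚ-mono-≤ (suc n) f≤g = +-mono-≤ (f≤g zero) (sumℚ-mono-≤ n (f≤g ∘ suc))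

sumℚ-zero : ∀ n → sumℚ n (λ _ → 0ℚ) ≡ 0ℚ
sumℚ-zero n = trans (sumℚ≡sum n _) (sum-replicate-zero n)

sumℚ-nonNeg : ∀ n {f : Fin n → ℚ} → (∀ j → 0ℚ ≤ℚ f j) → 0ℚ ≤ℚ sumℚ n f
sumℚ-nonNeg n 0≤f = subst (_≤ℚ sumℚ n _) (sumℚ-zero n) (sumℚ-mono-≤ n 0≤f)

sumℚ-distrib-+ : ∀ n (f g : Fin n → ℚ) →
                 sumℚ n (λ j → f j + g j) ≡ sumℚ n f + sumℚ n g
sumℚ-distrib-+ n f g = begin
  sumℚ n (λ j → f j + g j)  ≡⟨ sumℚ≡sum n _ ⟩
  sum (λ j → f j + g j)     ≡⟨ ∑-distrib-+ f g ⟩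
  sum f + sum g             ≡⟨ sym (cong₂ _+_ (sumℚ≡sum n f) (sumℚ≡sum n g)) ⟩
  sumℚ n f + sumℚ n g       ∎
  where open ≡-Reasoning

*-distribˡ-sumℚ : ∀ n c (f : Fin n → ℚ) → c * sumℚ n f ≡ sumℚ n (λ j → c * f j)
*-distribˡ-sumℚ n c f = begin
  c * sumℚ n f              ≡⟨ cong (c *_) (sumℚ≡sum n f) ⟩
  c * sum f                 ≡⟨ *-distribˡ-sum c f ⟩
  sum (λ j → c * f j)       ≡⟨ sym (sumℚ≡sum n _) ⟩
  sumℚ n (λ j → c * f j)    ∎
  where open ≡-Reasoning

sumℚ-comm : ∀ m n (f : Fin m → Fin n → ℚ) →
            sumℚ m (λ i → sumℚ n (f i)) ≡ sumℚ n (λ j → sumℚ m (λ i → f i j))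
sumℚ-comm m n f = begin
  sumℚ m (λ i → sumℚ n (f i))          ≡⟨ trans (sumℚ-cong m (λ i → sumℚ≡sum n (f i))) (sumℚ≡sum m _) ⟩
  sum (λ i → sum (f i))                ≡⟨ ∑-comm f ⟩
  sum (λ j → sum (λ i → f i j))        ≡⟨ sym (trans (sumℚ-cong n (λ j → sumℚ≡sum m _)) (sumℚ≡sum n _)) ⟩
  sumℚ n (λ j → sumℚ m (λ i → f i j))  ∎
  where open ≡-Reasoning

sumℚ-single : ∀ {n} (i₀ : Fin n) (f : Fin n → ℚ) → (∀ i → i ≢ i₀ → f i ≡ 0ℚ) →
              sumℚ n f ≡ f i₀
sumℚ-single {suc n} i₀ f vanish = begin
  sumℚ (suc n) f                        ≡⟨ sumℚ≡sum (suc n) f ⟩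
  sum f                                 ≡⟨ sum-remove {i = i₀} f ⟩
  f i₀ + sum (f ∘ punchIn i₀)           ≡⟨ cong (f i₀ +_) (sum-cong-≗ (λ k → vanish (punchIn i₀ k) (punchInᵢ≢i i₀ k))) ⟩
  f i₀ + sum {n} (λ _ → 0ℚ)             ≡⟨ cong (f i₀ +_) (sum-replicate-zero n) ⟩
  f i₀ + 0ℚ                             ≡⟨ +-identityʳ (f i₀) ⟩
  f i₀                                  ∎
  where open ≡-Reasoning

sumℚ-count : ∀ n (p : Fin n → Bool) c →
             sumℚ n (λ i → if p i then c else 0ℚ) ≡ ℕ→ℚ (count n p) * c
sumℚ-count zero    p c = sym (*-zeroˡ c)
sumℚ-count (suc n) p c with p zero
... | false = trans (+-identityˡ _) (sumℚ-count n (p ∘ suc) c)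
... | true  = begin
  c + sumℚ n (λ i → if p (suc i) then c else 0ℚ)  ≡⟨ cong (c +_) (sumℚ-count n (p ∘ suc) c) ⟩
  c + ℕ→ℚ m * c                                    ≡⟨ cong (_+ ℕ→ℚ m * c) (sym (*-identityˡ c)) ⟩
  1ℚ * c + ℕ→ℚ m * c                               ≡⟨ sym (*-distribʳ-+ c 1ℚ (ℕ→ℚ m)) ⟩
  (1ℚ + ℕ→ℚ m) * c                                 ≡⟨ cong (_* c) (sym (ℕ→ℚ-suc m)) ⟩
  ℕ→ℚ (suc m) * c                                  ∎
  where
  open ≡-Reasoning
  m = count n (p ∘ suc)

sumℚ-linear : ∀ n p q (f g : Fin n → ℚ) →
              sumℚ n (λ i → p * f i + q * g i) ≡ p * sumℚ n f + q * sumℚ n g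
sumℚ-linear n p q f g =
  trans (sumℚ-distrib-+ n _ _) (sym (cong₂ _+_ (*-distribˡ-sumℚ n p f) (*-distribˡ-sumℚ n q g)))

sumℚ-double-count : ∀ m n d (a : Fin m → Fin n → Bool) (g : Fin n → ℚ) →
  (∀ j → 0ℚ ≤ℚ g j) → (∀ j → count m (λ i → a i j) ≤ d) →
  sumℚ m (λ i → sumℚ n (λ j → if a i j then g j else 0ℚ)) ≤ℚ ℕ→ℚ d * sumℚ n g
sumℚ-double-count m n d a g 0≤g deg = begin
  sumℚ m (λ i → sumℚ n (λ j → if a i j then g j else 0ℚ))  ≡⟨ sumℚ-comm m n _ ⟩
  sumℚ n (λ j → sumℚ m (λ i → if a i j then g j else 0ℚ))  ≡⟨ sumℚ-cong n (λ j → sumℚ-count m (λ i → a i j) (g j)) ⟩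
  sumℚ n (λ j → ℕ→ℚ (count m (λ i → a i j)) * g j)         ≤⟨ sumℚ-mono-≤ n count-bound ⟩
  sumℚ n (λ j → ℕ→ℚ d * g j)                                ≡⟨ *-distribˡ-sumℚ n (ℕ→ℚ d) g ⟨
  ℕ→ℚ d * sumℚ n g                                          ∎
  where
  open ≤-Reasoning
  count-bound : ∀ j → ℕ→ℚ (count m (λ i → a i j)) * g j ≤ℚ ℕ→ℚ d * g j
  count-bound j = *-monoʳ-≤-nonNeg (g j) {{nonNegative (0≤g j)}} (ℕ→ℚ-mono-≤ (deg j))

charging : ∀ {c K β x w} → 0ℚ ≤ℚ c → c ≤ℚ K → 0ℚ ≤ℚ x → x ≤ℚ w →
           (x ≤ℚ c * β → K * β ≤ℚ w) →
           (c * K) * β + c * x ≤ℚ K * x + c * w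
charging {c} {K} {β} {x} {w} 0≤c c≤K 0≤x x≤w unsaturated with ≤-total (c * β) x
... | inj₁ cβ≤x = begin
  (c * K) * β + c * x  ≡⟨ cong (_+ c * x) (trans (cong (_* β) (*-comm c K)) (*-assoc K c β)) ⟩
  K * (c * β) + c * x  ≤⟨ +-mono-≤ (*-monoˡ-≤-nonNeg K {{nonNegative (≤-trans 0≤c c≤K)}} cβ≤x)
                                   (*-monoˡ-≤-nonNeg c {{nonNegative 0≤c}} x≤w) ⟩
  K * x + c * w        ∎
  where open ≤-Reasoning
... | inj₂ x≤cβ = begin
  (c * K) * β + c * x  ≡⟨ cong (_+ c * x) (*-assoc c K β) ⟩
  c * (K * β) + c * x  ≤⟨ +-mono-≤ (*-monoˡ-≤-nonNeg c {{nonNegative 0≤c}} (unsaturated x≤cβ))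
                                   (*-monoʳ-≤-nonNeg x {{nonNegative 0≤x}} c≤K) ⟩
  c * w + K * x        ≡⟨ +-comm (c * w) (K * x) ⟩
  K * x + c * w        ∎
  where open ≤-Reasoning

ratio-from-charging : ∀ {c K D opt S A W} → 0ℚ ≤ℚ c → 0ℚ ≤ℚ c * K → opt ≤ℚ S →
  (c * K) * S + c * A ≤ℚ K * A + c * W → W ≤ℚ (1ℚ + D) * A →
  (c * K) * opt ≤ℚ (K + D * c) * A
ratio-from-charging {c} {K} {D} {opt} {S} {A} {W} 0≤c 0≤cK opt≤S charged W≤ = begin
  (c * K) * opt                        ≤⟨ *-monoˡ-≤-nonNeg (c * K) {{nonNegative 0≤cK}} opt≤S ⟩
  (c * K) * S                          ≡⟨ add-sub c K S A ⟩
  (c * K) * S + c * A - c * A          ≤⟨ +-monoˡ-≤ (- (c * A)) charged ⟩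
  K * A + c * W - c * A                ≤⟨ +-monoˡ-≤ (- (c * A)) (+-monoʳ-≤ (K * A) (*-monoˡ-≤-nonNeg c {{nonNegative 0≤c}} W≤)) ⟩
  K * A + c * ((1ℚ + D) * A) - c * A   ≡⟨ collect K A c D ⟩
  (K + D * c) * A                      ∎
  where
  open ≤-Reasoning
  add-sub : ∀ c K S A → (c * K) * S ≡ (c * K) * S + c * A - c * A
  add-sub = solve 4 (λ c K S A → (c :* K) :* S := (c :* K) :* S :+ c :* A :- c :* A) refl
  collect : ∀ K A c D → K * A + c * ((1ℚ + D) * A) - c * A ≡ (K + D * c) * A
  collect = solve 4 (λ K A c D → K :* A :+ c :* ((con 1ℚ :+ D) :* A) :- c :* A := (K :+ D :* c) :* A) refl

≟F-refl : ∀ {n} (i : Fin n) → (i ≟F i) ≡ true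
≟F-refl i with i F.≟ i
... | yes _   = refl
... | no i≢i = contradiction refl i≢i

≟F-≢ : ∀ {n} {i j : Fin n} → i ≢ j → (i ≟F j) ≡ false
≟F-≢ {i = i} {j} i≢j with i F.≟ j
... | yes i≡j = contradiction i≡j i≢j
... | no _    = refl

module _ {nL nR : ℕ} (I : Instance nL nR) where

  AlongEdges : Allocation nL nR → Set
  AlongEdges ρ = ∀ i j → ρ j ≡ just i → adj I i j ≡ true

  payment : Allocation nL nR → Fin nL → Fin nR → ℚ
  payment ρ i j = if assignedTo ρ i j then b I i j else 0ℚ

  adjacentGain : Allocation nL nR → Fin nL → ℚ
  adjacentGain ρ i = sumℚ nR (λ j → if adj I i j then gain I ρ j else 0ℚ)

  payments-on-slot : ∀ ρ j → sumℚ nL (λ i → payment ρ i j) ≡ gain I ρ j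
  payments-on-slot ρ j with ρ j
  ... | nothing = sumℚ-zero nL
  ... | just i₀ = trans (sumℚ-single i₀ _ vanish) (cong (λ t → if t then b I i₀ j else 0ℚ) (≟F-refl i₀))
    where
    vanish : ∀ i → i ≢ i₀ → (if i₀ ≟F i then b I i j else 0ℚ) ≡ 0ℚ
    vanish i i≢i₀ rewrite ≟F-≢ (i≢i₀ ∘ sym) = refl

  ∑spent≡value : ∀ ρ → sumℚ nL (spent I ρ) ≡ value I ρ
  ∑spent≡value ρ = trans (sumℚ-comm nL nR (payment ρ)) (sumℚ-cong nR (payments-on-slot ρ))

  module _ {ρ : Allocation nL nR} (along : AlongEdges ρ) where

    gain-nonNeg : ∀ j → 0ℚ ≤ℚ gain I ρ j
    gain-nonNeg j with ρ j in eq
    ... | just i  = <⇒≤ (b-pos I i j (along i j eq))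
    ... | nothing = ≤-refl

    payment-nonNeg : ∀ i j → 0ℚ ≤ℚ payment ρ i j
    payment-nonNeg i j with ρ j in eq
    ... | nothing = ≤-refl
    ... | just i' with i' F.≟ i
    ...   | yes refl = <⇒≤ (b-pos I i j (along i j eq))
    ...   | no _     = ≤-refl

    spent-nonNeg : ∀ i → 0ℚ ≤ℚ spent I ρ i
    spent-nonNeg i = sumℚ-nonNeg nR (payment-nonNeg i)

    spentOn-≤-spent : ∀ i inc → spentOn I ρ i inc ≤ℚ spent I ρ i
    spentOn-≤-spent i inc = sumℚ-mono-≤ nR filtered
      where
      filtered : ∀ j → (if inc j then payment ρ i j else 0ℚ) ≤ℚ payment ρ i j
      filtered j with inc j
      ... | true  = ≤-refl
      ... | false = payment-nonNeg i j

    spent-≤-adjacentGain : ∀ i → spent I ρ i ≤ℚ adjacentGain ρ i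
    spent-≤-adjacentGain i = sumℚ-mono-≤ nR payment≤gain
      where
      payment≤gain : ∀ j → payment ρ i j ≤ℚ (if adj I i j then gain I ρ j else 0ℚ)
      payment≤gain j with ρ j in eq
      ... | nothing with adj I i j
      ...   | true  = ≤-refl
      ...   | false = ≤-refl
      payment≤gain j | just i' with i' F.≟ i
      ...   | yes refl rewrite along i j eq = ≤-refl
      ...   | no _ with adj I i j
      ...     | true  = <⇒≤ (b-pos I i' j (along i' j eq))
      ...     | false = ≤-refl

    ∑adjacentGain-≤ : ∀ d → (∀ j → count nL (λ i → adj I i j) ≤ d) →
                      sumℚ nL (adjacentGain ρ) ≤ℚ ℕ→ℚ d * value I ρ
    ∑adjacentGain-≤ d = sumℚ-double-count nL nR d (adj I) (gain I ρ) gain-nonNeg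

  feasible⇒value≤∑B : ∀ {τ} → Feasible I τ → value I τ ≤ℚ sumℚ nL (B I)
  feasible⇒value≤∑B {τ} (_ , within-budget) =
    subst (_≤ℚ sumℚ nL (B I)) (∑spent≡value τ) (sumℚ-mono-≤ nL within-budget)

  IsRmax⇒pos : ∀ {R} → IsRmax I R → 0ℚ <ℚ R
  IsRmax⇒pos {R} (_ , i , j , ij∈E , b≡RB) =
    *-cancelʳ-<-nonNeg (B I i) {{nonNegative (<⇒≤ (B-pos I i))}} 0·B<R·B
    where
    0·B<R·B : 0ℚ * B I i <ℚ R * B I i
    0·B<R·B = subst₂ _<ℚ_ (sym (*-zeroˡ (B I i))) b≡RB (b-pos I i j ij∈E)

  module _ {σ : Allocation nL nR} (greedy : GreedyRun I σ) where

    greedy-along-edges : AlongEdges σ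
    greedy-along-edges i j σj≡i = proj₁ (proj₁ (proj₁ (greedy j) i σj≡i))

    feasibleChoice⇒bid≤gain : ∀ {i j} → FeasibleChoice I σ i j → b I i j ≤ℚ gain I σ j
    feasibleChoice⇒bid≤gain {i} {j} feasible with σ j in eq
    ... | just i' = proj₂ (proj₁ (greedy j) i' eq) i feasible
    ... | nothing = contradiction feasible (proj₂ (greedy j) eq i)

    unsaturated⇒adjacentBids≤adjacentGain : ∀ {R} →
      (∀ i j → adj I i j ≡ true → b I i j ≤ℚ R * B I i) →
      ∀ i → spent I σ i ≤ℚ (1ℚ - R) * B I i →
      sumℚ nR (λ j → if adj I i j then b I i j else 0ℚ) ≤ℚ adjacentGain σ i
    unsaturated⇒adjacentBids≤adjacentGain {R} bids≤RB i unsaturated = sumℚ-mono-≤ nR bid≤gain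
      where
      bid≤residual : ∀ j → adj I i j ≡ true → b I i j ≤ℚ residual I σ i j
      bid≤residual j ij∈E = begin
        b I i j                   ≤⟨ bids≤RB i j ij∈E ⟩
        R * B I i                 ≡⟨ solve 2 (λ β R → R :* β := β :- (con 1ℚ :- R) :* β) refl (B I i) R ⟩
        B I i - (1ℚ - R) * B I i  ≤⟨ +-monoʳ-≤ (B I i) (neg-antimono-≤ unsaturated) ⟩
        B I i - spent I σ i       ≤⟨ +-monoʳ-≤ (B I i) (neg-antimono-≤ (spentOn-≤-spent greedy-along-edges i (before j))) ⟩
        residual I σ i j          ∎
        where open ≤-Reasoning
      bid≤gain : ∀ j → (if adj I i j then b I i j else 0ℚ) ≤ℚ (if adj I i j then gain I σ j else 0ℚ)
      bid≤gain j with adj I i j in ij∈E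
      ... | true  = feasibleChoice⇒bid≤gain (ij∈E , bid≤residual j ij∈E)
      ... | false = ≤-refl

    greedy-charging : ∀ {K R} → 0ℚ ≤ℚ 1ℚ - R → 1ℚ - R ≤ℚ K →
      (∀ i → K * B I i ≤ℚ sumℚ nR (λ j → if adj I i j then b I i j else 0ℚ)) →
      (∀ i j → adj I i j ≡ true → b I i j ≤ℚ R * B I i) →
      ((1ℚ - R) * K) * sumℚ nL (B I) + (1ℚ - R) * value I σ
        ≤ℚ K * value I σ + (1ℚ - R) * sumℚ nL (adjacentGain σ)
    greedy-charging {K} {R} 0≤c c≤K budgets≤bids bids≤RB =
      subst₂ _≤ℚ_
        (trans (sumℚ-linear nL (c * K) c (B I) (spent I σ))
               (cong (λ A → (c * K) * sumℚ nL (B I) + c * A) ∑X≡A))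
        (trans (sumℚ-linear nL K c (spent I σ) (adjacentGain σ))
               (cong (λ A → K * A + c * sumℚ nL (adjacentGain σ)) ∑X≡A))
        (sumℚ-mono-≤ nL per-advertiser)
      where
      c = 1ℚ - R
      ∑X≡A : sumℚ nL (spent I σ) ≡ value I σ
      ∑X≡A = ∑spent≡value σ
      per-advertiser : ∀ i → (c * K) * B I i + c * spent I σ i ≤ℚ K * spent I σ i + c * adjacentGain σ i
      per-advertiser i =
        charging 0≤c c≤K (spent-nonNeg greedy-along-edges i) (spent-≤-adjacentGain greedy-along-edges i)
          (≤-trans (budgets≤bids i) ∘ unsaturated⇒adjacentBids≤adjacentGain {R} bids≤RB i)

mainTheorem2 : (k d : ℕ) → 1 ≤ k → 1 ≤ d →
    (nL nR : ℕ) (I : Instance nL nR) → Bounded k d I →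
    (R : ℚ) → IsRmax I R → R <ℚ 1ℚ →
    (σ : Allocation nL nR) → GreedyRun I σ →
    (τ : Allocation nL nR) → Feasible I τ →
    ((1ℚ - R) * ℕ→ℚ k) * value I τ
      ≤ℚ (ℕ→ℚ k + ℕ→ℚ (d ∸ 1) * (1ℚ - R)) * value I σ
mainTheorem2 k (suc d) 1≤k (s≤s z≤n) nL nR I (degrees≤ , budgets≤bids) R rmax R<1 σ greedy τ τ-feasible =
  ratio-from-charging {D = ℕ→ℚ d} 0≤c 0≤cK (feasible⇒value≤∑B I τ-feasible)
    (greedy-charging I greedy {R = R} 0≤c c≤K budgets≤bids (proj₁ rmax))
    double-counted
  where
  c K : ℚ
  c = 1ℚ - R
  K = ℕ→ℚ k
  0≤c : 0ℚ ≤ℚ c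
  0≤c = subst (_≤ℚ c) (+-inverseʳ R) (+-monoˡ-≤ (- R) (<⇒≤ R<1))
  c≤K : c ≤ℚ K
  c≤K = ≤-trans {j = 1ℚ} (+-monoʳ-≤ 1ℚ (neg-antimono-≤ (<⇒≤ (IsRmax⇒pos I {R} rmax)))) (ℕ→ℚ-mono-≤ 1≤k)
  0≤cK : 0ℚ ≤ℚ c * K
  0≤cK = subst (_≤ℚ c * K) (*-zeroʳ c) (*-monoˡ-≤-nonNeg c {{nonNegative 0≤c}} (ℕ→ℚ-nonNeg k))
  double-counted : sumℚ nL (adjacentGain I σ) ≤ℚ (1ℚ + ℕ→ℚ d) * value I σ
  double-counted = subst (λ D → sumℚ nL (adjacentGain I σ) ≤ℚ D * value I σ) (ℕ→ℚ-suc d)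
    (∑adjacentGain-≤ I (greedy-along-edges I greedy) (suc d) degrees≤)
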